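{- For every term $\mathfrak{t}$ over $\{\mathsf{M}\}$, the restriction of the map $\mathrm{fr}$ to $\mathcal{P}(\mathfrak{t}) = \{\mathfrak{s} : \mathfrak{t}\preccurlyeq\mathfrak{s}\}$ is injective.
   Context: Terms over $\{\mathsf{M}\}$: variables $\mathsf{x}_i$, the constant $\mathsf{M}$, and applications $\mathfrak{t}_1\mathfrak{t}_2$ (binary trees). $\mathfrak{t}\Rightarrow\mathfrak{t}'$ iff $\mathfrak{t}'$ is obtained from $\mathfrak{t}$ by replacing one subterm $\mathsf{M}\mathfrak{s}$ by $\mathfrak{s}\mathfrak{s}$; $\preccurlyeq$ is its reflexive transitive closure. A duplicative forest is a finite word of duplicative trees (empty word $\epsilon$ allowed); a duplicative tree is $\circ(\mathfrak{g})$ or $\bullet(\mathfrak{g})$ for a duplicative forest $\mathfrak{g}$; $\cdot$ is concatenation. The map $\mathrm{fr}$: $\mathrm{fr}(\mathsf{x}_i):=\epsilon$, $\mathrm{fr}(\mathsf{M}):=\epsilon$, $\mathrm{fr}(\mathfrak{t}\mathfrak{t}') := \circ(\mathrm{fr}(\mathfrak{t}'))$ if $\mathfrak{t}=\mathsf{M}$ and $\mathfrak{t}'\ne\mathsf{M}$, and $\mathrm{fr}(\mathfrak{t}\mathfrak{t}') := \bullet(\mathrm{fr}(\mathfrak{t})\cdot\mathrm{fr}(\mathfrak{t}'))$ otherwise. -}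

module Defs where

open import Data.Nat using (ℕ)
open import Data.List using (List; []; _∷_; _++_)
open import Relation.Binary.Construct.Closure.ReflexiveTransitive using (Star)

data Term : Set where
  var : ℕ → Term
  M   : Term
  _·_ : Term → Term → Term

infixl 9 _·_

data _⇒_ : Term → Term → Set where
  root  : ∀ {s} → (M · s) ⇒ (s · s)
  left  : ∀ {t t' u} → t ⇒ t' → (t · u) ⇒ (t' · u)
  right : ∀ {t u u'} → u ⇒ u' → (t · u) ⇒ (t · u')

_≼_ : Term → Term → Set
_≼_ = Star _⇒_

data DTree : Set where
  ∘ : List DTree → DTree
  • : List DTree → DTree

DForest : Set
DForest = List DTree

fr : Term → DForest
fr (var i) = []
fr M = []
fr (M · M) = • [] ∷ []
fr (M · var i) = ∘ (fr (var i)) ∷ []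
fr (M · (t · u)) = ∘ (fr (t · u)) ∷ []
fr (var i · u) = • (fr (var i) ++ fr u) ∷ []
fr ((t · t') · u) = • (fr (t · t') ++ fr u) ∷ []

{-# OPTIONS --safe #-}
-- The reducts of t are described structurally by a relation t ⊑ s: a node of t
-- that is not of the form M · u keeps its head and has its children replaced by
-- such descendants, while a node M · u (u ≢ M) either stays M · b or has been
-- duplicated into a · b, where a and b descend from u (M · M only rewrites to
-- itself and is kept apart, as fr treats it specially).  This relation contains
-- the identity and is closed under ⇒, so it contains ≼.  On two descendants of
-- the same t, fr can be inverted node by node: descendants of a leaf are that
-- leaf, descendants of an application have a one-tree forest, so the
-- concatenations fr a ++ fr b split at the same place, and ∘ versus • tells
-- whether a node M · u has been duplicated.
module Submission where

open import Defs
open import Data.List using (List; []; _∷_; _++_; length)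
open import Data.List.Properties using (∷-injective)
open import Data.Nat.Properties using (suc-injective)
open import Data.Product using (_×_; _,_)
open import Relation.Binary.Construct.Closure.ReflexiveTransitive using (ε; _◅_)
open import Relation.Binary.PropositionalEquality
  using (_≡_; _≢_; refl; sym; trans; cong; cong₂)
open import Relation.Nullary using (contradiction)

++-cancel-sameLength : ∀ {A : Set} (xs xs' : List A) {ys ys' : List A} →
  length xs ≡ length xs' → xs ++ ys ≡ xs' ++ ys' → xs ≡ xs' × ys ≡ ys'
++-cancel-sameLength []       []        _   eq = refl , eq
++-cancel-sameLength (x ∷ xs) (x' ∷ xs') len eq
  with refl , eq′ ← ∷-injective eq
  with refl , eq″ ← ++-cancel-sameLength xs xs' (suc-injective len) eq′
  = refl , eq″

fr-M· : ∀ {u} → u ≢ M → fr (M · u) ≡ ∘ (fr u) ∷ []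
fr-M· {var i} _   = refl
fr-M· {M}     u≢M = contradiction refl u≢M
fr-M· {t · u} _   = refl

fr-· : ∀ {t u} → t ≢ M → fr (t · u) ≡ • (fr t ++ fr u) ∷ []
fr-· {var i}  _   = refl
fr-· {M}      t≢M = contradiction refl t≢M
fr-· {t · t'} _   = refl

length-fr-· : ∀ t u → length (fr (t · u)) ≡ 1
length-fr-· M        M        = refl
length-fr-· M        (var i)  = refl
length-fr-· M        (t · u)  = refl
length-fr-· (var i)  u        = refl
length-fr-· (t · t') u        = refl

infix 4 _⊑_

data _⊑_ : Term → Term → Set where
  var  : ∀ {i} → var i ⊑ var i
  M    : M ⊑ M
  M·M  : M · M ⊑ M · M
  app  : ∀ {t u a b} → t ≢ M → t ⊑ a → u ⊑ b → t · u ⊑ a · b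
  keep : ∀ {u b} → u ≢ M → u ⊑ b → M · u ⊑ M · b
  dup  : ∀ {u a b} → u ≢ M → u ⊑ a → u ⊑ b → M · u ⊑ a · b

⊑-refl : ∀ t → t ⊑ t
⊑-refl (var i)        = var
⊑-refl M              = M
⊑-refl (M · M)        = M·M
⊑-refl (M · var i)    = keep (λ ()) var
⊑-refl (M · (t · u))  = keep (λ ()) (⊑-refl (t · u))
⊑-refl (var i · u)    = app (λ ()) var (⊑-refl u)
⊑-refl ((t · t') · u) = app (λ ()) (⊑-refl (t · t')) (⊑-refl u)

⊑-≢M : ∀ {t a} → t ⊑ a → t ≢ M → a ≢ M
⊑-≢M M t≢M refl = t≢M refl

⊑-step : ∀ {t s s'} → t ⊑ s → s ⇒ s' → t ⊑ s'
⊑-step M·M               root       = M·M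
⊑-step (app t≢M t⊑M _)   root       = contradiction refl (⊑-≢M t⊑M t≢M)
⊑-step (app t≢M t⊑a u⊑b) (left st)  = app t≢M (⊑-step t⊑a st) u⊑b
⊑-step (app t≢M t⊑a u⊑b) (right st) = app t≢M t⊑a (⊑-step u⊑b st)
⊑-step (keep u≢M u⊑b)    root       = dup u≢M u⊑b u⊑b
⊑-step (keep u≢M u⊑b)    (right st) = keep u≢M (⊑-step u⊑b st)
⊑-step (dup u≢M u⊑M _)   root       = contradiction refl (⊑-≢M u⊑M u≢M)
⊑-step (dup u≢M u⊑a u⊑b) (left st)  = dup u≢M (⊑-step u⊑a st) u⊑b
⊑-step (dup u≢M u⊑a u⊑b) (right st) = dup u≢M u⊑a (⊑-step u⊑b st)

≼⇒⊑ : ∀ {t s} → t ≼ s → t ⊑ s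
≼⇒⊑ {t} = go (⊑-refl t)
  where
  go : ∀ {s s'} → t ⊑ s → s ≼ s' → t ⊑ s'
  go t⊑s ε          = t⊑s
  go t⊑s (st ◅ sts) = go (⊑-step t⊑s st) sts

⊑-length-fr : ∀ {t a} → t ⊑ a → length (fr a) ≡ length (fr t)
⊑-length-fr var                         = refl
⊑-length-fr M                           = refl
⊑-length-fr M·M                         = refl
⊑-length-fr (app {t} {u} {a} {b} _ _ _) = trans (length-fr-· a b) (sym (length-fr-· t u))
⊑-length-fr (keep {u} {b} _ _)          = trans (length-fr-· M b) (sym (length-fr-· M u))
⊑-length-fr (dup {u} {a} {b} _ _ _)     = trans (length-fr-· a b) (sym (length-fr-· M u))

•-injective : ∀ {xs ys} → • xs ∷ [] ≡ • ys ∷ [] → xs ≡ ys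
•-injective refl = refl

∘-injective : ∀ {xs ys} → ∘ xs ∷ [] ≡ ∘ ys ∷ [] → xs ≡ ys
∘-injective refl = refl

∘≢• : ∀ {xs ys} → ∘ xs ∷ [] ≢ • ys ∷ []
∘≢• ()

fr-M·-injective : ∀ {b b'} → b ≢ M → b' ≢ M → fr (M · b) ≡ fr (M · b') → fr b ≡ fr b'
fr-M·-injective b≢M b'≢M e = ∘-injective (trans (sym (fr-M· b≢M)) (trans e (fr-M· b'≢M)))

fr-M·≢fr-· : ∀ {b a a'} → b ≢ M → a ≢ M → fr (M · b) ≢ fr (a · a')
fr-M·≢fr-· b≢M a≢M e = ∘≢• (trans (sym (fr-M· b≢M)) (trans e (fr-· a≢M)))

fr-·-split : ∀ {t a a' b b'} → t ≢ M → t ⊑ a → t ⊑ a' →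
  fr (a · b) ≡ fr (a' · b') → fr a ≡ fr a' × fr b ≡ fr b'
fr-·-split {a = a} {a'} t≢M t⊑a t⊑a' e =
  ++-cancel-sameLength (fr a) (fr a')
    (trans (⊑-length-fr t⊑a) (sym (⊑-length-fr t⊑a')))
    (•-injective (trans (sym (fr-· (⊑-≢M t⊑a t≢M))) (trans e (fr-· (⊑-≢M t⊑a' t≢M)))))

fr-injective-on-⊑ : ∀ {t s s'} → t ⊑ s → t ⊑ s' → fr s ≡ fr s' → s ≡ s'
fr-injective-on-⊑ var var _ = refl
fr-injective-on-⊑ M   M   _ = refl
fr-injective-on-⊑ M·M M·M _ = refl
fr-injective-on-⊑ M·M (app t≢M _ _) _ = contradiction refl t≢M
fr-injective-on-⊑ M·M (keep u≢M _)  _ = contradiction refl u≢M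
fr-injective-on-⊑ M·M (dup u≢M _ _) _ = contradiction refl u≢M
fr-injective-on-⊑ (app t≢M _ _) M·M         _ = contradiction refl t≢M
fr-injective-on-⊑ (app t≢M _ _) (keep _ _)  _ = contradiction refl t≢M
fr-injective-on-⊑ (app t≢M _ _) (dup _ _ _) _ = contradiction refl t≢M
fr-injective-on-⊑ (keep _ _)  (app t≢M _ _) _ = contradiction refl t≢M
fr-injective-on-⊑ (dup _ _ _) (app t≢M _ _) _ = contradiction refl t≢M
fr-injective-on-⊑ (keep u≢M _)  M·M _ = contradiction refl u≢M
fr-injective-on-⊑ (dup u≢M _ _) M·M _ = contradiction refl u≢M
fr-injective-on-⊑ (app t≢M t⊑a u⊑b) (app _ t⊑a' u⊑b') e
  with ea , eb ← fr-·-split t≢M t⊑a t⊑a' e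
  = cong₂ _·_ (fr-injective-on-⊑ t⊑a t⊑a' ea) (fr-injective-on-⊑ u⊑b u⊑b' eb)
fr-injective-on-⊑ (keep u≢M u⊑b) (keep _ u⊑b') e =
  cong (M ·_) (fr-injective-on-⊑ u⊑b u⊑b' (fr-M·-injective (⊑-≢M u⊑b u≢M) (⊑-≢M u⊑b' u≢M) e))
fr-injective-on-⊑ (keep u≢M u⊑b) (dup _ u⊑a' _) e =
  contradiction e (fr-M·≢fr-· (⊑-≢M u⊑b u≢M) (⊑-≢M u⊑a' u≢M))
fr-injective-on-⊑ (dup u≢M u⊑a _) (keep _ u⊑b') e =
  contradiction (sym e) (fr-M·≢fr-· (⊑-≢M u⊑b' u≢M) (⊑-≢M u⊑a u≢M))
fr-injective-on-⊑ (dup u≢M u⊑a u⊑b) (dup _ u⊑a' u⊑b') e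
  with ea , eb ← fr-·-split u≢M u⊑a u⊑a' e
  = cong₂ _·_ (fr-injective-on-⊑ u⊑a u⊑a' ea) (fr-injective-on-⊑ u⊑b u⊑b' eb)

lemma2p3p1 : (t s s' : Term) → t ≼ s → t ≼ s' → fr s ≡ fr s' → s ≡ s'
lemma2p3p1 t s s' t≼s t≼s' = fr-injective-on-⊑ (≼⇒⊑ t≼s) (≼⇒⊑ t≼s')
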